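{- In $\mathcal G_{ -5,-3}(\mathbb Z/5\mathbb Z)$ let $A$ be the image of $\{1+xi+yij : x,y\in\mathbb Z/5\mathbb Z\}$ and $B$ the image of $\{j+xi+yij : x,y\in\mathbb Z/5\mathbb Z\}$, and let $H=A\cup B$. Then $H$ is a subgroup of $\mathcal G_{ -5,-3}(\mathbb Z/5\mathbb Z)$ isomorphic to a semidirect product $C_5\rtimes D_5$.
   Context: $\mathcal H_{ -5,-3}$ is the quaternion algebra over $\mathbb Q$ with basis $1,i,j,ij$, $i^2=-5$, $j^2=-3$, $ij=-ji$, and $\mathcal O_{ -5,-3}=\mathbb Z\oplus\mathbb Z\omega_1\oplus\mathbb Z\omega_2\oplus\mathbb Z\omega_3$ with $\omega_1=\frac{1+j}2$, $\omega_2=\frac{i+ij}2$, $\omega_3=\frac{j+ij}3$ (a maximal order). For a commutative ring $A'$, $\mathcal G_{ -5,-3}(A')=(\mathcal O_{ -5,-3}\otimes A')^\times/A'^\times$; note $\mathcal O_{ -5,-3}\otimes\mathbb Z/5\mathbb Z$ has $\mathbb Z/5\mathbb Z$-basis $1,i,j,ij$. $C_5$ is cyclic of order $5$ and $D_5$ is dihedral of order $10$. -}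

module Defs where

open import Data.Nat using (ℕ; _+_; _*_)
open import Data.Nat.DivMod using (_mod_)
open import Data.Fin using (Fin; toℕ)
open import Data.Bool using (Bool; true; false; _xor_)
open import Data.Product using (Σ; ∃; ∃-syntax; _×_; _,_)
open import Data.Sum using (_⊎_)
open import Relation.Binary.PropositionalEquality using (_≡_; _≢_)

Z5 : Set
Z5 = Fin 5

fromℕ5 : ℕ → Z5
fromℕ5 n = n mod 5

_+₅_ : Z5 → Z5 → Z5
a +₅ b = fromℕ5 (toℕ a + toℕ b)

_*₅_ : Z5 → Z5 → Z5
a *₅ b = fromℕ5 (toℕ a * toℕ b)

neg₅ : Z5 → Z5
neg₅ a = fromℕ5 (4 * toℕ a)   -- -a ≡ 4a (mod 5)

_-₅_ : Z5 → Z5 → Z5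
a -₅ b = a +₅ neg₅ b

0₅ 1₅ : Z5
0₅ = fromℕ5 0
1₅ = fromℕ5 1

-- O_{-5,-3} ⊗ ℤ/5ℤ, with ℤ/5ℤ-basis 1, i, j, ij (k := ij)
-- i² = α = -5, j² = β = -3, ij = -ji.

α β : Z5
α = neg₅ (fromℕ5 5)
β = neg₅ (fromℕ5 3)

record Quat : Set where
  constructor quat
  field
    c1 ci cj ck : Z5
open Quat public

-- Multiplication, using i² = α, j² = β, k² = -αβ, ij = k, ji = -k,
-- ik = αj, ki = -αj, jk = -βi, kj = βi.
_·_ : Quat → Quat → Quat
quat a b c d · quat a' b' c' d' = quat
  (((a *₅ a') +₅ (α *₅ (b *₅ b'))) +₅ ((β *₅ (c *₅ c')) -₅ ((α *₅ β) *₅ (d *₅ d'))))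
  (((a *₅ b') +₅ (b *₅ a')) +₅ ((β *₅ (d *₅ c')) -₅ (β *₅ (c *₅ d'))))
  (((a *₅ c') +₅ (c *₅ a')) +₅ ((α *₅ (b *₅ d')) -₅ (α *₅ (d *₅ b'))))
  (((a *₅ d') +₅ (d *₅ a')) +₅ ((b *₅ c') -₅ (c *₅ b')))

scal : Z5 → Quat → Quat
scal l (quat a b c d) = quat (l *₅ a) (l *₅ b) (l *₅ c) (l *₅ d)

one : Quat
one = quat 1₅ 0₅ 0₅ 0₅

IsUnit : Quat → Set
IsUnit p = ∃[ r ] ((p · r ≡ one) × (r · p ≡ one))

-- equality in G(ℤ/5ℤ) = (O ⊗ ℤ/5ℤ)^× / (ℤ/5ℤ)^× : equal up to a unit scalar
_∼_ : Quat → Quat → Set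
p ∼ q = ∃[ l ] ((l ≢ 0₅) × (p ≡ scal l q))

aElt bElt : Z5 → Z5 → Quat
aElt x y = quat 1₅ x 0₅ y
bElt x y = quat 0₅ x 1₅ y

InH : Quat → Set
InH q = ∃[ x ] ∃[ y ] ((q ∼ aElt x y) ⊎ (q ∼ bElt x y))

-- C₅ = (ℤ/5ℤ, +), D₅ = {ρ^r σ^s}, with σ ρ σ⁻¹ = ρ⁻¹.

D5 : Set
D5 = Z5 × Bool

_∘D_ : D5 → D5 → D5
(r , false) ∘D (r' , s') = (r +₅ r' , s')
(r , true)  ∘D (r' , s') = (r -₅ r' , true xor s')

-- homomorphisms D₅ → Aut(C₅) ≅ (ℤ/5ℤ)^× (a ↦ multiplication by a unit)
IsAction : (D5 → Z5) → Set
IsAction φ = ((h : D5) → φ h ≢ 0₅) × ((h h' : D5) → φ (h ∘D h') ≡ (φ h *₅ φ h'))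

SD : Set
SD = Z5 × D5

sdMul : (D5 → Z5) → SD → SD → SD
sdMul φ (n , h) (n' , h') = (n +₅ (φ h *₅ n') , h ∘D h')

IsSubgroupH : Set
IsSubgroupH =
  ((q : Quat) → InH q → IsUnit q) ×
  InH one ×
  ((p q : Quat) → InH p → InH q → InH (p · q)) ×
  ((p : Quat) → InH p → ∃[ r ] (InH r × ((p · r) ∼ one)))

IsIsoOntoH : (φ : D5 → Z5) → (SD → Quat) → Set
IsIsoOntoH φ f =
  ((g : SD) → InH (f g)) ×
  ((g g' : SD) → f (sdMul φ g g') ∼ (f g · f g')) ×
  ((g g' : SD) → f g ∼ f g' → g ≡ g') ×
  ((q : Quat) → InH q → ∃[ g ] (f g ∼ q))

{-# OPTIONS --safe #-}
-- Modulo 5 both α = -5 and αβ vanish, so i and ij square to zero and annihilate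
-- each other: A = {1 + x i + y ij} is a copy of C₅ × C₅, with (1 + x i)(1 + y ij) =
-- 1 + x i + y ij. Conjugation by j negates i and ij, and j² = β is a scalar, so j has
-- order 2 in G(ℤ/5ℤ) and H = A ⋊ ⟨j⟩. Splitting A = ⟨1 + ij⟩ × ⟨1 + i⟩ gives
-- H ≅ C₅ ⋊ D₅ with D₅ = ⟨1 + i, j⟩, whose reflections invert C₅ = ⟨1 + ij⟩.
-- Since scalars are central, everything reduces to finitely many identities in the
-- 50 representatives (1 + n ij)(1 + r i) jˢ, which are checked by evaluation.
module Submission where

open import Defs
open import Data.Product using (∃; ∃-syntax; _×_; _,_)
open import Data.Product.Properties using (≡-dec)
open import Data.Sum using (inj₁; inj₂)
open import Data.Bool using (Bool; true; false)
open import Data.Bool.Properties using () renaming (_≟_ to _≟B_)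
open import Data.Fin.Properties using (all?) renaming (_≟_ to _≟F_)
open import Relation.Nullary using (Dec; yes; no; ¬?)
open import Relation.Nullary.Decidable using (from-yes; map′; _→-dec_)
open import Relation.Binary.Definitions using (DecidableEquality)
open import Relation.Binary.PropositionalEquality
  using (_≡_; _≢_; refl; sym; trans; cong; cong₂; module ≡-Reasoning)

_≟Q_ : DecidableEquality Quat
quat a b c d ≟Q quat a′ b′ c′ d′ with a ≟F a′ | b ≟F b′ | c ≟F c′ | d ≟F d′
... | yes refl | yes refl | yes refl | yes refl = yes refl
... | no a≢a′  | _        | _        | _        = no λ { refl → a≢a′ refl }
... | yes _    | no b≢b′  | _        | _        = no λ { refl → b≢b′ refl }
... | yes _    | yes _    | no c≢c′  | _        = no λ { refl → c≢c′ refl }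
... | yes _    | yes _    | yes _    | no d≢d′  = no λ { refl → d≢d′ refl }

_≟SD_ : DecidableEquality SD
_≟SD_ = ≡-dec _≟F_ (≡-dec _≟F_ _≟B_)

all-Bool? : {P : Bool → Set} → Dec (P false) → Dec (P true) → Dec (∀ b → P b)
all-Bool? (yes p) (yes q) = yes λ { false → p ; true → q }
all-Bool? (no ¬p) _       = no λ h → ¬p (h false)
all-Bool? (yes _) (no ¬q) = no λ h → ¬q (h true)

all-SD? : {P : SD → Set} → (∀ g → Dec (P g)) → Dec (∀ g → P g)
all-SD? P? = map′ (λ h (n , r , s) → h n r s) (λ h n r s → h (n , r , s))
  (all? λ n → all? λ r → all-Bool? (P? (n , r , false)) (P? (n , r , true)))

*₅-assoc : ∀ x y z → (x *₅ y) *₅ z ≡ x *₅ (y *₅ z)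
*₅-assoc = from-yes (all? λ x → all? λ y → all? λ z → ((x *₅ y) *₅ z) ≟F (x *₅ (y *₅ z)))

*₅-comm : ∀ x y → x *₅ y ≡ y *₅ x
*₅-comm = from-yes (all? λ x → all? λ y → (x *₅ y) ≟F (y *₅ x))

*₅-identityˡ : ∀ x → 1₅ *₅ x ≡ x
*₅-identityˡ = from-yes (all? λ x → (1₅ *₅ x) ≟F x)

*₅-distribˡ-+₅ : ∀ l x y → l *₅ (x +₅ y) ≡ (l *₅ x) +₅ (l *₅ y)
*₅-distribˡ-+₅ = from-yes (all? λ l → all? λ x → all? λ y →
  (l *₅ (x +₅ y)) ≟F ((l *₅ x) +₅ (l *₅ y)))

*₅-distribˡ--₅ : ∀ l x y → l *₅ (x -₅ y) ≡ (l *₅ x) -₅ (l *₅ y)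
*₅-distribˡ--₅ = from-yes (all? λ l → all? λ x → all? λ y →
  (l *₅ (x -₅ y)) ≟F ((l *₅ x) -₅ (l *₅ y)))

*₅-nonzero : ∀ x y → x ≢ 0₅ → y ≢ 0₅ → x *₅ y ≢ 0₅
*₅-nonzero = from-yes (all? λ x → all? λ y →
  ¬? (x ≟F 0₅) →-dec ¬? (y ≟F 0₅) →-dec ¬? ((x *₅ y) ≟F 0₅))

-- Fermat: x⁴ = 1 for x ≠ 0.
inv₅ : Z5 → Z5
inv₅ x = (x *₅ x) *₅ x

inv₅-inverseˡ : ∀ x → x ≢ 0₅ → inv₅ x *₅ x ≡ 1₅
inv₅-inverseˡ = from-yes (all? λ x → ¬? (x ≟F 0₅) →-dec ((inv₅ x *₅ x) ≟F 1₅))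

inv₅-nonzero : ∀ x → x ≢ 0₅ → inv₅ x ≢ 0₅
inv₅-nonzero = from-yes (all? λ x → ¬? (x ≟F 0₅) →-dec ¬? (inv₅ x ≟F 0₅))

*₅-leftComm : ∀ l x y → x *₅ (l *₅ y) ≡ l *₅ (x *₅ y)
*₅-leftComm l x y = begin
  x *₅ (l *₅ y)  ≡⟨ sym (*₅-assoc x l y) ⟩
  (x *₅ l) *₅ y  ≡⟨ cong (_*₅ y) (*₅-comm x l) ⟩
  (l *₅ x) *₅ y  ≡⟨ *₅-assoc l x y ⟩
  l *₅ (x *₅ y)  ∎
  where open ≡-Reasoning

*₅-pullˡ : ∀ c l x y → c *₅ ((l *₅ x) *₅ y) ≡ l *₅ (c *₅ (x *₅ y))
*₅-pullˡ c l x y = trans (cong (c *₅_) (*₅-assoc l x y)) (*₅-leftComm l c _)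

*₅-pullʳ : ∀ c l x y → c *₅ (x *₅ (l *₅ y)) ≡ l *₅ (c *₅ (x *₅ y))
*₅-pullʳ c l x y = trans (cong (c *₅_) (*₅-leftComm l x y)) (*₅-leftComm l c _)

quat-cong : ∀ {a b c d a′ b′ c′ d′} → a ≡ a′ → b ≡ b′ → c ≡ c′ → d ≡ d′ →
            quat a b c d ≡ quat a′ b′ c′ d′
quat-cong refl refl refl refl = refl

-- Every coordinate of a product has the shape (X₁ + X₂) + (X₃ - X₄).
scal-combination : ∀ l Y₁ Y₂ Y₃ Y₄ {X₁ X₂ X₃ X₄} →
  X₁ ≡ l *₅ Y₁ → X₂ ≡ l *₅ Y₂ → X₃ ≡ l *₅ Y₃ → X₄ ≡ l *₅ Y₄ →
  (X₁ +₅ X₂) +₅ (X₃ -₅ X₄) ≡ l *₅ ((Y₁ +₅ Y₂) +₅ (Y₃ -₅ Y₄))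
scal-combination l Y₁ Y₂ Y₃ Y₄ refl refl refl refl = sym (trans
  (*₅-distribˡ-+₅ l (Y₁ +₅ Y₂) (Y₃ -₅ Y₄))
  (cong₂ _+₅_ (*₅-distribˡ-+₅ l Y₁ Y₂) (*₅-distribˡ--₅ l Y₃ Y₄)))

scal-· : ∀ l p q → scal l p · q ≡ scal l (p · q)
scal-· l (quat a b c d) (quat a′ b′ c′ d′) = quat-cong
  (scal-combination l _ _ _ _
    (*₅-assoc l a a′) (*₅-pullˡ α l b b′) (*₅-pullˡ β l c c′) (*₅-pullˡ (α *₅ β) l d d′))
  (scal-combination l _ _ _ _
    (*₅-assoc l a b′) (*₅-assoc l b a′) (*₅-pullˡ β l d c′) (*₅-pullˡ β l c d′))
  (scal-combination l _ _ _ _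
    (*₅-assoc l a c′) (*₅-assoc l c a′) (*₅-pullˡ α l b d′) (*₅-pullˡ α l d b′))
  (scal-combination l _ _ _ _
    (*₅-assoc l a d′) (*₅-assoc l d a′) (*₅-assoc l b c′) (*₅-assoc l c b′))

·-scal : ∀ l p q → p · scal l q ≡ scal l (p · q)
·-scal l (quat a b c d) (quat a′ b′ c′ d′) = quat-cong
  (scal-combination l _ _ _ _
    (*₅-leftComm l a a′) (*₅-pullʳ α l b b′) (*₅-pullʳ β l c c′) (*₅-pullʳ (α *₅ β) l d d′))
  (scal-combination l _ _ _ _
    (*₅-leftComm l a b′) (*₅-leftComm l b a′) (*₅-pullʳ β l d c′) (*₅-pullʳ β l c d′))
  (scal-combination l _ _ _ _
    (*₅-leftComm l a c′) (*₅-leftComm l c a′) (*₅-pullʳ α l b d′) (*₅-pullʳ α l d b′))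
  (scal-combination l _ _ _ _
    (*₅-leftComm l a d′) (*₅-leftComm l d a′) (*₅-leftComm l b c′) (*₅-leftComm l c b′))

scal-scal : ∀ l m q → scal l (scal m q) ≡ scal (l *₅ m) q
scal-scal l m (quat a b c d) =
  quat-cong (sym (*₅-assoc l m a)) (sym (*₅-assoc l m b)) (sym (*₅-assoc l m c)) (sym (*₅-assoc l m d))

scal-identity : ∀ q → scal 1₅ q ≡ q
scal-identity (quat a b c d) =
  quat-cong (*₅-identityˡ a) (*₅-identityˡ b) (*₅-identityˡ c) (*₅-identityˡ d)

scal-inverse : ∀ l q → l ≢ 0₅ → scal (inv₅ l) (scal l q) ≡ q
scal-inverse l q l≢0 = begin
  scal (inv₅ l) (scal l q)  ≡⟨ scal-scal (inv₅ l) l q ⟩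
  scal (inv₅ l *₅ l) q      ≡⟨ cong (λ z → scal z q) (inv₅-inverseˡ l l≢0) ⟩
  scal 1₅ q                 ≡⟨ scal-identity q ⟩
  q                         ∎
  where open ≡-Reasoning

∼-reflexive : ∀ {p q} → p ≡ q → p ∼ q
∼-reflexive {q = q} refl = 1₅ , (λ ()) , sym (scal-identity q)

∼-sym : ∀ {p q} → p ∼ q → q ∼ p
∼-sym {q = q} (l , l≢0 , refl) = inv₅ l , inv₅-nonzero l l≢0 , sym (scal-inverse l q l≢0)

∼-trans : ∀ {p q r} → p ∼ q → q ∼ r → p ∼ r
∼-trans {r = r} (l , l≢0 , refl) (m , m≢0 , refl) =
  l *₅ m , *₅-nonzero l m l≢0 m≢0 , scal-scal l m r

·-cong-∼ : ∀ {p p′ q q′} → p ∼ p′ → q ∼ q′ → (p · q) ∼ (p′ · q′)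
·-cong-∼ {p′ = p′} {q′ = q′} (l , l≢0 , refl) (m , m≢0 , refl) =
  l *₅ m , *₅-nonzero l m l≢0 m≢0 , (begin
    scal l p′ · scal m q′      ≡⟨ scal-· l p′ (scal m q′) ⟩
    scal l (p′ · scal m q′)    ≡⟨ cong (scal l) (·-scal m p′ q′) ⟩
    scal l (scal m (p′ · q′))  ≡⟨ scal-scal l m (p′ · q′) ⟩
    scal (l *₅ m) (p′ · q′)    ∎)
  where open ≡-Reasoning

signAction : D5 → Z5
signAction (_ , false) = 1₅
signAction (_ , true)  = neg₅ 1₅

signAction-isAction : IsAction signAction
signAction-isAction =
  (λ { (_ , false) () ; (_ , true) () }) ,
  (λ { (_ , false) (_ , false) → refl ; (_ , false) (_ , true) → refl
     ; (_ , true)  (_ , false) → refl ; (_ , true)  (_ , true) → refl })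

_⋆_ : SD → SD → SD
_⋆_ = sdMul signAction

sdIdentity : SD
sdIdentity = 0₅ , 0₅ , false

sdInv : SD → SD
sdInv (n , r , false) = neg₅ n , neg₅ r , false
sdInv (n , r , true)  = n , r , true

⋆-inverseʳ : ∀ g → g ⋆ sdInv g ≡ sdIdentity
⋆-inverseʳ = from-yes (all-SD? λ g → (g ⋆ sdInv g) ≟SD sdIdentity)

⋆-inverseˡ : ∀ g → sdInv g ⋆ g ≡ sdIdentity
⋆-inverseˡ = from-yes (all-SD? λ g → (sdInv g ⋆ g) ≟SD sdIdentity)

-- (n , r , s) ↦ (1 + n ij)(1 + r i) jˢ, expanded using ij·j = βi and β = 2.
toH : SD → Quat
toH (n , r , false) = aElt r n
toH (n , r , true)  = bElt (β *₅ n) r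

toH-identity : toH sdIdentity ≡ one
toH-identity = refl

-- Nontrivial only for two reflections, where the product contains j · j = β.
cocycle : SD → SD → Z5
cocycle (_ , _ , true) (_ , _ , true) = β
cocycle _              _              = 1₅

cocycle-nonzero : ∀ g h → cocycle g h ≢ 0₅
cocycle-nonzero (_ , _ , true)  (_ , _ , true)  ()
cocycle-nonzero (_ , _ , true)  (_ , _ , false) ()
cocycle-nonzero (_ , _ , false) (_ , _ , true)  ()
cocycle-nonzero (_ , _ , false) (_ , _ , false) ()

cocycle-inverse : ∀ g → cocycle g (sdInv g) ≡ cocycle (sdInv g) g
cocycle-inverse (_ , _ , false) = refl
cocycle-inverse (_ , _ , true)  = refl

toH-·-cocycle : ∀ g h → toH g · toH h ≡ scal (cocycle g h) (toH (g ⋆ h))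
toH-·-cocycle = from-yes (all-SD? λ g → all-SD? λ h →
  (toH g · toH h) ≟Q scal (cocycle g h) (toH (g ⋆ h)))

toH-·-inverses : ∀ g h → g ⋆ h ≡ sdIdentity → toH g · toH h ≡ scal (cocycle g h) one
toH-·-inverses g h gh≡e = trans (toH-·-cocycle g h) (cong (λ z → scal (cocycle g h) (toH z)) gh≡e)

toH-homomorphic : ∀ g h → (toH g · toH h) ∼ toH (g ⋆ h)
toH-homomorphic g h = cocycle g h , cocycle-nonzero g h , toH-·-cocycle g h

toH-injective : ∀ g h l → toH g ≡ scal l (toH h) → g ≡ h
toH-injective = from-yes (all-SD? λ g → all-SD? λ h → all? λ l →
  (toH g ≟Q scal l (toH h)) →-dec (g ≟SD h))

β-cancel : ∀ x → β *₅ (fromℕ5 3 *₅ x) ≡ x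
β-cancel x = trans (sym (*₅-assoc β (fromℕ5 3) x)) (*₅-identityˡ x)

InH⇒∼toH : ∀ {q} → InH q → ∃[ g ] (q ∼ toH g)
InH⇒∼toH (x , y , inj₁ q∼a) = (y , x , false) , q∼a
InH⇒∼toH (x , y , inj₂ q∼b) =
  (fromℕ5 3 *₅ x , y , true) , ∼-trans q∼b (∼-reflexive (cong (λ z → bElt z y) (sym (β-cancel x))))

∼toH⇒InH : ∀ {q} g → q ∼ toH g → InH q
∼toH⇒InH (n , r , false) q∼a = r , n , inj₁ q∼a
∼toH⇒InH (n , r , true)  q∼b = β *₅ n , r , inj₂ q∼b

InH-invertible : ∀ {p} → InH p → ∃[ r ] (InH r × (p · r ≡ one) × (r · p ≡ one))
InH-invertible hp with InH⇒∼toH hp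
... | g , l , l≢0 , refl =
  r , ∼toH⇒InH (sdInv g) (m , inv₅-nonzero (l *₅ c) lc≢0 , refl) ,
  trans (·-scal m (scal l (toH g)) _) (cancel _ (begin
    scal l (toH g) · toH (sdInv g)           ≡⟨ scal-· l (toH g) _ ⟩
    scal l (toH g · toH (sdInv g))           ≡⟨ cong (scal l) (toH-·-inverses g (sdInv g) (⋆-inverseʳ g)) ⟩
    scal l (scal c one)                      ∎)) ,
  trans (scal-· m (toH (sdInv g)) _) (cancel _ (begin
    toH (sdInv g) · scal l (toH g)           ≡⟨ ·-scal l (toH (sdInv g)) (toH g) ⟩
    scal l (toH (sdInv g) · toH g)           ≡⟨ cong (scal l) (toH-·-inverses (sdInv g) g (⋆-inverseˡ g)) ⟩
    scal l (scal (cocycle (sdInv g) g) one)  ≡⟨ cong (λ z → scal l (scal z one)) (sym (cocycle-inverse g)) ⟩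
    scal l (scal c one)                      ∎))
  where
  open ≡-Reasoning
  c : Z5
  c = cocycle g (sdInv g)
  lc≢0 : l *₅ c ≢ 0₅
  lc≢0 = *₅-nonzero l c l≢0 (cocycle-nonzero g (sdInv g))
  m : Z5
  m = inv₅ (l *₅ c)
  r : Quat
  r = scal m (toH (sdInv g))

  cancel : ∀ q → q ≡ scal l (scal c one) → scal m q ≡ one
  cancel q refl = trans (cong (scal m) (scal-scal l c one)) (scal-inverse (l *₅ c) one lc≢0)

InH-·-closed : ∀ p q → InH p → InH q → InH (p · q)
InH-·-closed p q hp hq with InH⇒∼toH hp | InH⇒∼toH hq
... | g , p∼g | h , q∼h = ∼toH⇒InH (g ⋆ h) (∼-trans (·-cong-∼ p∼g q∼h) (toH-homomorphic g h))

H-isSubgroup : IsSubgroupH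
H-isSubgroup =
  (λ q hq → let (r , _ , qr≡1 , rq≡1) = InH-invertible hq in r , qr≡1 , rq≡1) ,
  ∼toH⇒InH sdIdentity (∼-reflexive toH-identity) ,
  InH-·-closed ,
  (λ p hp → let (r , hr , pr≡1 , _) = InH-invertible hp in r , hr , ∼-reflexive pr≡1)

toH-isIsoOntoH : IsIsoOntoH signAction toH
toH-isIsoOntoH =
  (λ g → ∼toH⇒InH g (∼-reflexive refl)) ,
  (λ g h → ∼-sym (toH-homomorphic g h)) ,
  (λ { g h (l , _ , g≡lh) → toH-injective g h l g≡lh }) ,
  (λ q hq → let (g , q∼g) = InH⇒∼toH hq in g , ∼-sym q∼g)

lemma5p8 : IsSubgroupH × (∃[ φ ] (IsAction φ × ∃[ f ] IsIsoOntoH φ f))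
lemma5p8 = H-isSubgroup , signAction , signAction-isAction , toH , toH-isIsoOntoH
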